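{- Every strongly connected circular graph is complete and co-complete.
   Context: A graph is a non-empty set $G\subseteq V\times A\times V$ of labelled edges $s\xrightarrow{a}t$ (for some label set $A$); $V_G$ is the set of vertices occurring in edges and $A_G$ the set of labels occurring on edges. $G$ is strongly connected if every vertex reaches every vertex by a directed path. For $u=a_1\cdots a_n$, $s\xrightarrow{u}t$ means there is a path $s=s_0\xrightarrow{a_1}s_1\cdots\xrightarrow{a_n}s_n=t$; $\mathrm{L}_G(s,s)=\{u\mid s\xrightarrow{u}s\}$; $G$ is circular if $\mathrm{L}_G(s,s)=\mathrm{L}_G(t,t)$ for all $s,t\in V_G$. $G$ is complete if for every $s\in V_G$ and $a\in A_G$ there is $t$ with $s\xrightarrow{a}t$; co-complete if for every $t\in V_G$ and $a\in A_G$ there is $s$ with $s\xrightarrow{a}t$. -}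

module Defs where

open import Level using (Level; _⊔_; suc)
open import Data.List using (List; []; _∷_)
open import Data.Product using (Σ; ∃; _×_; _,_)
open import Function.Bundles using (_⇔_)

Graph : ∀ {v a} (V : Set v) (A : Set a) (ℓ : Level) → Set (v ⊔ a ⊔ suc ℓ)
Graph V A ℓ = V → A → V → Set ℓ

module _ {v a ℓ} {V : Set v} {A : Set a} (G : Graph V A ℓ) where

  NonEmpty : Set (v ⊔ a ⊔ ℓ)
  NonEmpty = ∃ λ s → ∃ λ x → ∃ λ t → G s x t

  InV : V → Set (v ⊔ a ⊔ ℓ)
  InV s = (∃ λ x → ∃ λ t → G s x t) Data.Sum.⊎ (∃ λ r → ∃ λ x → G r x s)
    where import Data.Sum

  InA : A → Set (v ⊔ ℓ)
  InA x = ∃ λ s → ∃ λ t → G s x t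

  data Path : V → List A → V → Set (v ⊔ a ⊔ ℓ) where
    ε   : ∀ {s} → Path s [] s
    _◅_ : ∀ {s x r u t} → G s x r → Path r u t → Path s (x ∷ u) t

  Reaches : V → V → Set (v ⊔ a ⊔ ℓ)
  Reaches s t = ∃ λ u → Path s u t

  L : V → List A → Set (v ⊔ a ⊔ ℓ)
  L s u = Path s u s

  StronglyConnected : Set (v ⊔ a ⊔ ℓ)
  StronglyConnected = ∀ s t → InV s → InV t → Reaches s t

  Circular : Set (v ⊔ a ⊔ ℓ)
  Circular = ∀ s t → InV s → InV t → ∀ u → L s u ⇔ L t u

  Complete : Set (v ⊔ a ⊔ ℓ)
  Complete = ∀ s x → InV s → InA x → ∃ λ t → G s x t

  CoComplete : Set (v ⊔ a ⊔ ℓ)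
  CoComplete = ∀ t x → InV t → InA x → ∃ λ s → G s x t

-- An edge s --x--> t lies on a cycle, because strong connectivity gives a
-- path u back from t to s: the words x u and u x are in L(s,s) and L(t,t).
-- Circularity moves these cycles to any vertex r, so r has a cycle that
-- starts with x and one that ends with x; their first and last edges are
-- the outgoing and incoming x-edges at r.
module Submission where

open import Defs
open import Data.Product using (_×_; _,_; ∃)
open import Data.List using (List; []; _∷_; _++_; [_])
open import Data.Sum using (inj₁; inj₂)
open import Function.Bundles using (Equivalence)

module _ {v a ℓ} {V : Set v} {A : Set a} {G : Graph V A ℓ} where

  infixr 5 _◅◅_
  _◅◅_ : ∀ {s u t w r} → Path G s u t → Path G t w r → Path G s (u ++ w) r
  ε ◅◅ q = q
  (e ◅ p) ◅◅ q = e ◅ (p ◅◅ q)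

  head-edge : ∀ {s x u t} → Path G s (x ∷ u) t → ∃ λ r → G s x r
  head-edge (e ◅ _) = _ , e

  last-edge : ∀ {s t} u {x} → Path G s (u ++ [ x ]) t → ∃ λ r → G r x t
  last-edge []      (e ◅ ε) = _ , e
  last-edge (_ ∷ u) (_ ◅ p) = last-edge u p

  source-InV : ∀ {s x t} → G s x t → InV G s
  source-InV e = inj₁ (_ , _ , e)

  target-InV : ∀ {s x t} → G s x t → InV G t
  target-InV e = inj₂ (_ , _ , e)

  module _ (sc : StronglyConnected G) (circ : Circular G) {s x t} (e : G s x t) where

    private
      return-path : ∃ λ u → Path G t u s
      return-path = sc t s (target-InV e) (source-InV e)

    cycle-starting-with : ∀ {r} → InV G r → ∃ λ u → L G r (x ∷ u)
    cycle-starting-with {r} r∈V with return-path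
    ... | u , p = u , Equivalence.to (circ s r (source-InV e) r∈V (x ∷ u)) (e ◅ p)

    cycle-ending-with : ∀ {r} → InV G r → ∃ λ u → L G r (u ++ [ x ])
    cycle-ending-with {r} r∈V with return-path
    ... | u , p = u , Equivalence.to (circ t r (target-InV e) r∈V (u ++ [ x ])) (p ◅◅ e ◅ ε)

lemma4p8 : ∀ {v a ℓ} {V : Set v} {A : Set a} (G : Graph V A ℓ) →
    NonEmpty G → StronglyConnected G → Circular G →
    Complete G × CoComplete G
lemma4p8 G _ sc circ = complete , co-complete
  where
  complete : Complete G
  complete s x s∈V (_ , _ , e) with cycle-starting-with sc circ e s∈V
  ... | _ , c = head-edge c

  co-complete : CoComplete G
  co-complete t x t∈V (_ , _ , e) with cycle-ending-with sc circ e t∈V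
  ... | u , c = last-edge u c
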